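{- Let $h,n\ge2$ and $U,V\le G=S_h\times S_n$ be such that $\langle U,V\rangle$ is regular. (i) If $U\le_{\mathcal P}V$, then $\mathcal F^V\subseteq\mathcal F^U$. (ii) If $U\cong_{\mathcal P}V$, then $\mathcal F^V=\mathcal F^U$.
   Context: $\mathcal P=(S_n)^h$ with $G$ acting by $p^{(\varphi,\psi)}$ having $i$-th component $\psi\,p_{\varphi^{ -1}(i)}$ (products are compositions). For $U\le G$, $p^U=\{p^u:u\in U\}$. $U\le G$ is regular if $\{u\in U:p^u=p\}\subseteq S_h\times\{id\}$ for every $p\in\mathcal P$. For $U,V\le G$, write $U\le_{\mathcal P}V$ if $p^U\subseteq p^V$ for all $p\in\mathcal P$, and $U\cong_{\mathcal P}V$ if both $U\le_{\mathcal P}V$ and $V\le_{\mathcal P}U$. For $U\le G$, $\mathcal F^U$ is the set of maps $F:\mathcal P\to S_n$ with $F(p^{(\varphi,\psi)})=\psi F(p)$ for all $p\in\mathcal P$, $(\varphi,\psi)\in U$. -}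

module Defs where

open import Data.Nat.Base using (ℕ)
open import Data.Fin.Base using (Fin)
open import Data.Fin.Permutation using (Permutation′; _⟨$⟩ʳ_; _⟨$⟩ˡ_; _∘ₚ_; flip)
  renaming (id to idₚ)
open import Data.Product.Base using (_×_; _,_; proj₁; proj₂; ∃-syntax)
open import Relation.Binary.PropositionalEquality using (_≡_)

Sym : ℕ → Set
Sym n = Permutation′ n

infix 4 _≈ₚ_
_≈ₚ_ : ∀ {n} → Sym n → Sym n → Set
π ≈ₚ ρ = ∀ i → π ⟨$⟩ʳ i ≡ ρ ⟨$⟩ʳ i

-- composition  ψ · p  =  ψ ∘ p  (first p, then ψ)
infixr 9 _·_
_·_ : ∀ {n} → Sym n → Sym n → Sym n
ψ · p = p ∘ₚ ψ

_⁻¹ : ∀ {n} → Sym n → Sym n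
π ⁻¹ = flip π

G : ℕ → ℕ → Set
G h n = Sym h × Sym n

infix 4 _≈G_
_≈G_ : ∀ {h n} → G h n → G h n → Set
(φ , ψ) ≈G (φ' , ψ') = (φ ≈ₚ φ') × (ψ ≈ₚ ψ')

εG : ∀ {h n} → G h n
εG = idₚ , idₚ

_∙G_ : ∀ {h n} → G h n → G h n → G h n
(φ , ψ) ∙G (φ' , ψ') = (φ · φ') , (ψ · ψ')

invG : ∀ {h n} → G h n → G h n
invG (φ , ψ) = (φ ⁻¹) , (ψ ⁻¹)

record IsSubgroup {h n : ℕ} (U : G h n → Set) : Set where
  field
    resp : ∀ {g g'} → g ≈G g' → U g → U g'
    ε∈   : U εG
    ∙∈   : ∀ {g g'} → U g → U g' → U (g ∙G g')
    inv∈ : ∀ {g} → U g → U (invG g)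

data ⟨_,_⟩ {h n : ℕ} (U V : G h n → Set) : G h n → Set where
  inU  : ∀ {g} → U g → ⟨ U , V ⟩ g
  inV  : ∀ {g} → V g → ⟨ U , V ⟩ g
  ε∈   : ⟨ U , V ⟩ εG
  ∙∈   : ∀ {g g'} → ⟨ U , V ⟩ g → ⟨ U , V ⟩ g' → ⟨ U , V ⟩ (g ∙G g')
  inv∈ : ∀ {g} → ⟨ U , V ⟩ g → ⟨ U , V ⟩ (invG g)
  resp : ∀ {g g'} → g ≈G g' → ⟨ U , V ⟩ g → ⟨ U , V ⟩ g'

Prof : ℕ → ℕ → Set
Prof h n = Fin h → Sym n

infix 4 _≈P_
_≈P_ : ∀ {h n} → Prof h n → Prof h n → Set
p ≈P q = ∀ i → p i ≈ₚ q i

_^_ : ∀ {h n} → Prof h n → G h n → Prof h n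
(p ^ (φ , ψ)) i = ψ · p (φ ⟨$⟩ˡ i)

Regular : ∀ {h n} → (G h n → Set) → Set
Regular {h} {n} U = ∀ (p : Prof h n) (u : G h n) → U u → p ^ u ≈P p → proj₂ u ≈ₚ idₚ

_≤𝒫_ : ∀ {h n} → (G h n → Set) → (G h n → Set) → Set
_≤𝒫_ {h} {n} U V = ∀ (p : Prof h n) (u : G h n) → U u → ∃[ v ] (V v × p ^ u ≈P p ^ v)

_≅𝒫_ : ∀ {h n} → (G h n → Set) → (G h n → Set) → Set
U ≅𝒫 V = (U ≤𝒫 V) × (V ≤𝒫 U)

record PMap (h n : ℕ) : Set where
  field
    F    : Prof h n → Sym n
    cong : ∀ {p q} → p ≈P q → F p ≈ₚ F q
open PMap public

_∈𝓕_ : ∀ {h n} → PMap h n → (G h n → Set) → Set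
_∈𝓕_ {h} {n} Φ U = ∀ (p : Prof h n) (φ : Sym h) (ψ : Sym n) → U (φ , ψ) →
  F Φ (p ^ (φ , ψ)) ≈ₚ ψ · F Φ p

-- If u = (φ , ψ) and v = (φ' , ψ') move a profile p to the same profile, then
-- u⁻¹v fixes p; when u and v lie in a regular subgroup this forces ψ = ψ'.
-- So for F ∈ 𝓕^V and u ∈ U, choosing v ∈ V with p^u = p^v gives
-- F(p^u) = F(p^v) = ψ' F(p) = ψ F(p), i.e. F ∈ 𝓕^U.
module Submission where

open import Defs
open import Data.Nat.Base using (ℕ; _≤_)
open import Data.Product.Base using (_×_; _,_; proj₂)
open import Data.Fin.Permutation using (_⟨$⟩ʳ_; _⟨$⟩ˡ_; inverseˡ; inverseʳ)
  renaming (id to idₚ)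
open import Relation.Binary.PropositionalEquality
  using (sym; module ≡-Reasoning)
  renaming (cong to ≡-cong)

⟨⟩-isSubgroup : ∀ {h n} (U V : G h n → Set) → IsSubgroup ⟨ U , V ⟩
⟨⟩-isSubgroup U V = record { resp = resp ; ε∈ = ε∈ ; ∙∈ = ∙∈ ; inv∈ = inv∈ }

^-agree⇒fixed-by-quotient : ∀ {h n} (p : Prof h n) (u v : G h n) →
  p ^ u ≈P p ^ v → p ^ (invG u ∙G v) ≈P p
^-agree⇒fixed-by-quotient p (φ , ψ) (φ' , ψ') p^u≈p^v i y = begin
  ψ ⟨$⟩ˡ (ψ' ⟨$⟩ʳ (p (φ' ⟨$⟩ˡ (φ ⟨$⟩ʳ i)) ⟨$⟩ʳ y))
    ≡⟨ ≡-cong (ψ ⟨$⟩ˡ_) (sym (p^u≈p^v (φ ⟨$⟩ʳ i) y)) ⟩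
  ψ ⟨$⟩ˡ (ψ ⟨$⟩ʳ (p (φ ⟨$⟩ˡ (φ ⟨$⟩ʳ i)) ⟨$⟩ʳ y))
    ≡⟨ inverseˡ ψ ⟩
  p (φ ⟨$⟩ˡ (φ ⟨$⟩ʳ i)) ⟨$⟩ʳ y
    ≡⟨ ≡-cong (λ j → p j ⟨$⟩ʳ y) (inverseˡ φ) ⟩
  p i ⟨$⟩ʳ y ∎
  where open ≡-Reasoning

regular-^-agree⇒proj₂-agree : ∀ {h n} {W : G h n → Set} → IsSubgroup W → Regular W →
  ∀ (p : Prof h n) {u v} → W u → W v → p ^ u ≈P p ^ v → proj₂ u ≈ₚ proj₂ v
regular-^-agree⇒proj₂-agree W≤G reg p {φ , ψ} {v} u∈W v∈W p^u≈p^v z = begin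
  ψ ⟨$⟩ʳ z                          ≡⟨ ≡-cong (ψ ⟨$⟩ʳ_) (sym (quotient-trivial z)) ⟩
  ψ ⟨$⟩ʳ (ψ ⟨$⟩ˡ (proj₂ v ⟨$⟩ʳ z))  ≡⟨ inverseʳ ψ ⟩
  proj₂ v ⟨$⟩ʳ z                    ∎
  where
  open ≡-Reasoning
  quotient-trivial : proj₂ (invG (φ , ψ) ∙G v) ≈ₚ idₚ
  quotient-trivial = reg p (invG (φ , ψ) ∙G v)
    (IsSubgroup.∙∈ W≤G (IsSubgroup.inv∈ W≤G u∈W) v∈W)
    (^-agree⇒fixed-by-quotient p (φ , ψ) v p^u≈p^v)

∈𝓕-antitone : ∀ {h n} {U V W : G h n → Set} → IsSubgroup W → Regular W →
  (∀ {g} → U g → W g) → (∀ {g} → V g → W g) →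
  U ≤𝒫 V → ∀ (Φ : PMap h n) → Φ ∈𝓕 V → Φ ∈𝓕 U
∈𝓕-antitone W≤G reg U⊆W V⊆W U≤V Φ Φ∈𝓕V p φ ψ u∈U x
  with U≤V p (φ , ψ) u∈U
... | (φ' , ψ') , v∈V , p^u≈p^v = begin
  F Φ (p ^ (φ , ψ)) ⟨$⟩ʳ x   ≡⟨ cong Φ p^u≈p^v x ⟩
  F Φ (p ^ (φ' , ψ')) ⟨$⟩ʳ x ≡⟨ Φ∈𝓕V p φ' ψ' v∈V x ⟩
  ψ' ⟨$⟩ʳ (F Φ p ⟨$⟩ʳ x)     ≡⟨ sym (ψ≈ψ' (F Φ p ⟨$⟩ʳ x)) ⟩
  ψ ⟨$⟩ʳ (F Φ p ⟨$⟩ʳ x)      ∎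
  where
  open ≡-Reasoning
  ψ≈ψ' : ψ ≈ₚ ψ'
  ψ≈ψ' = regular-^-agree⇒proj₂-agree W≤G reg p (U⊆W u∈U) (V⊆W v∈V) p^u≈p^v

proposition48 : ∀ (h n : ℕ) → 2 ≤ h → 2 ≤ n →
    (U V : G h n → Set) → IsSubgroup U → IsSubgroup V → Regular ⟨ U , V ⟩ →
    ((U ≤𝒫 V → ∀ (Φ : PMap h n) → Φ ∈𝓕 V → Φ ∈𝓕 U)
    × (U ≅𝒫 V → ∀ (Φ : PMap h n) → (Φ ∈𝓕 V → Φ ∈𝓕 U) × (Φ ∈𝓕 U → Φ ∈𝓕 V)))
proposition48 h n _ _ U V _ _ reg = part-i , part-ii
  where
  ⟨U,V⟩≤G = ⟨⟩-isSubgroup U V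

  part-i : U ≤𝒫 V → ∀ Φ → Φ ∈𝓕 V → Φ ∈𝓕 U
  part-i = ∈𝓕-antitone ⟨U,V⟩≤G reg inU inV

  part-ii : U ≅𝒫 V → ∀ Φ → (Φ ∈𝓕 V → Φ ∈𝓕 U) × (Φ ∈𝓕 U → Φ ∈𝓕 V)
  part-ii (U≤V , V≤U) Φ = part-i U≤V Φ , ∈𝓕-antitone ⟨U,V⟩≤G reg inV inU V≤U Φ
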